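{- Let $k$ be a positive integer. Let $G_1,\ldots, G_t$ be $t$ pairwise vertex-disjoint graphs, each of which is $k$-connected, and let $U=\{u_{t+1},\ldots,u_{t+s}\}$ be a set of $s$ vertices with $U\cap V(G_i)=\emptyset$ for every $1 \leq i\leq t$. Let $R$ be a $k$-connected graph on the vertex set $\{1,\ldots,t+s\}$. Let $X=(X_1,\ldots,X_{t+s}) = (G_1, \ldots, G_t, u_{t+1}, \ldots, u_{t+s})$, and write $V(X_i)=V(G_i)$ for $i\le t$ and $V(X_i)=\{u_i\}$ for $i>t$. Let $G$ be any graph satisfying: (i) the disjoint union of $G_1,\ldots,G_t$ together with the isolated vertices $u_{t+1},\ldots,u_{t+s}$ is a spanning subgraph of $G$; (ii) for all distinct $i,j\in\{1,\ldots,t+s\}$ with $ij\in E(R)$, there is an edge of $G$ with one endpoint in $V(X_i)$ and the other in $V(X_j)$; (iii) for every $1\leq i\leq t$, there are $k$ pairwise independent (vertex-disjoint) edges of $G$, each with one endpoint in $V(G_i)$, whose other endpoints lie respectively in $V(X_{j_1}),\ldots,V(X_{j_k})$ for $k$ distinct indices $j_1,\ldots,j_k\in\{1,\ldots,t+s\}\setminus\{i\}$. Then $G$ is $k$-connected.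
   Context: A graph is $k$-connected if one must remove at least $k$ vertices in order to disconnect it or to leave only a single vertex. -}

module Defs where

open import Data.Nat using (ℕ; suc; _<_; _+_)
open import Data.Fin using (Fin; splitAt)
open import Data.Fin.Subset using (Subset; _∈_; _∉_; ∣_∣)
open import Data.Sum using (_⊎_; inj₁; inj₂)
open import Data.Product using (Σ; ∃; _×_)
open import Relation.Nullary using (¬_; Dec)
open import Relation.Binary.PropositionalEquality using (_≡_; _≢_)
open import Level using (0ℓ)

record Graph (n : ℕ) : Set₁ where
  field
    Adj     : Fin n → Fin n → Set
    Adj-dec : ∀ u v → Dec (Adj u v)
    sym     : ∀ {u v} → Adj u v → Adj v u
    irrefl  : ∀ {u} → ¬ Adj u u

open Graph public

data WalkAvoiding {n : ℕ} (G : Graph n) (S : Subset n) : Fin n → Fin n → Set where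
  here  : ∀ {v} → v ∉ S → WalkAvoiding G S v v
  step  : ∀ {v w x} → v ∉ S → Adj G v w → WalkAvoiding G S w x → WalkAvoiding G S v x

ConnectedAvoiding : {n : ℕ} → Graph n → Subset n → Set
ConnectedAvoiding {n} G S = ∀ (v w : Fin n) → v ∉ S → w ∉ S → WalkAvoiding G S v w

-- k-connected: one must remove at least k vertices to disconnect G or to
-- leave only a single vertex.  Equivalently: G has more than k vertices
-- (removing n-1 vertices leaves a single vertex, so n-1 ≥ k) and removing
-- any set of fewer than k vertices leaves a connected graph.
KConnected : ℕ → {n : ℕ} → Graph n → Set
KConnected k {n} G = (k < n) × (∀ (S : Subset n) → ∣ S ∣ < k → ConnectedAvoiding G S)

-- Vertex v of G lies in V(X_i), where X = (G_1,…,G_t,u_{t+1},…,u_{t+s}),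
-- G_a embedded in G via emb a and u_{t+b} = u b.  Index i : Fin (t + s),
-- indices < t refer to the G_a, indices ≥ t to the single vertices.
InX : {t s n : ℕ} {m : Fin t → ℕ} →
      ((a : Fin t) → Fin (m a) → Fin n) → (Fin s → Fin n) →
      Fin (t + s) → Fin n → Set
InX {t} {s} emb u i v with splitAt t i
... | inj₁ a = ∃ λ x → emb a x ≡ v
... | inj₂ b = u b ≡ v

-- Let S be a set of fewer than k vertices of G and call an index i hit if
-- V(X_i) meets S; fewer than k indices are hit.  Each V(X_i) minus S is
-- connected in G − S, because the k-connected G_i loses fewer than k
-- vertices.  Every vertex v outside S reaches a part that is not hit: if
-- its own part G_i is hit, one of the k independent edges of (iii) avoids S
-- and leads to a part that is not hit, since otherwise each of these edges
-- would account for its own vertex of S.  Finally R minus the hit indices is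
-- connected, and by (ii) every edge of R between parts that are not hit is
-- realised by an edge of G − S, so any two vertices outside S are joined.
module Submission where

open import Defs
open import Data.Empty using (⊥-elim)
open import Data.Fin using (Fin; zero; suc; splitAt; _↑ˡ_)
open import Data.Fin.Properties
  using (any?; splitAt-↑ˡ; suc-injective; 0≢1+n; injective⇒≤) renaming (_≟_ to _≟ᶠ_)
open import Data.Fin.Subset
  using (Subset; inside; outside; _∈_; _∉_; ∣_∣; ⊤; _-_)
open import Data.Fin.Subset.Properties
  using (_∈?_; ∣⊤∣≡n; x∈p∧x≢y⇒x∈p-y; x∈p⇒∣p-x∣<∣p∣)
open import Data.Nat using (ℕ; zero; suc; _≤_; _<_; _+_; z≤n; s≤s)
open import Data.Nat.Properties using (≤-trans; ≤-<-trans; <-≤-trans; <⇒≱)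
open import Data.Product using (∃; _×_; _,_; proj₁; proj₂)
open import Data.Sum using (_⊎_; inj₁; inj₂)
open import Data.Vec.Base using (_∷_; []; here; there; tabulate)
open import Data.Vec.Properties using (lookup∘tabulate; []=⇒lookup; lookup⇒[]=)
open import Function using (_∘_)
open import Level using (0ℓ)
open import Relation.Nullary using (Dec; yes; no; does; proof; Reflects; invert)
open import Relation.Nullary.Decidable using (_×-dec_; ¬?; dec-true)
open import Relation.Unary using (Pred; Decidable)
open import Relation.Binary.PropositionalEquality
  using (_≡_; _≢_; refl; trans; subst)
open import Relation.Binary.PropositionalEquality as ≡ using ()

subset : ∀ {n} {P : Pred (Fin n) 0ℓ} → Decidable P → Subset n
subset P? = tabulate (does ∘ P?)

module _ {n} {P : Pred (Fin n) 0ℓ} (P? : Decidable P) where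

  ∈subset⁺ : ∀ {x} → P x → x ∈ subset P?
  ∈subset⁺ {x} px = lookup⇒[]= x _ (trans (lookup∘tabulate _ x) (dec-true (P? x) px))

  ∈subset⁻ : ∀ {x} → x ∈ subset P? → P x
  ∈subset⁻ {x} x∈ = invert (subst (Reflects (P x)) does≡inside (proof (P? x)))
    where
    does≡inside : does (P? x) ≡ inside
    does≡inside = trans (≡.sym (lookup∘tabulate _ x)) ([]=⇒lookup x∈)

injective⇒∣p∣≤∣q∣ : ∀ {m n} (F : Fin m → Fin n → Set) (p : Subset m) (q : Subset n) →
  (∀ {i} → i ∈ p → ∃ λ j → j ∈ q × F i j) →
  (∀ {i i′ j} → F i j → F i′ j → i ≡ i′) →
  ∣ p ∣ ≤ ∣ q ∣
injective⇒∣p∣≤∣q∣ F [] q total inj = z≤n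
injective⇒∣p∣≤∣q∣ F (outside ∷ p) q total inj =
  injective⇒∣p∣≤∣q∣ (F ∘ suc) p q (total ∘ there) (λ e e′ → suc-injective (inj e e′))
injective⇒∣p∣≤∣q∣ F (inside ∷ p) q total inj with total here
... | j₀ , j₀∈q , F0j₀ =
  ≤-trans (s≤s (injective⇒∣p∣≤∣q∣ (F ∘ suc) p (q - j₀) total′ (λ e e′ → suc-injective (inj e e′))))
          (x∈p⇒∣p-x∣<∣p∣ j₀∈q)
  where
  total′ : ∀ {i} → i ∈ p → ∃ λ j → j ∈ q - j₀ × F (suc i) j
  total′ i∈p with total (there i∈p)
  ... | j , j∈q , Fij = j , x∈p∧x≢y⇒x∈p-y j∈q (λ { refl → 0≢1+n (inj F0j₀ Fij) }) , Fij

module _ {n} {G : Graph n} {S : Subset n} where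

  infixr 5 _++_

  _++_ : ∀ {a b c} → WalkAvoiding G S a b → WalkAvoiding G S b c → WalkAvoiding G S a c
  here _       ++ w′ = w′
  step a∉ e w ++ w′ = step a∉ e (w ++ w′)

  source∉ : ∀ {a b} → WalkAvoiding G S a b → a ∉ S
  source∉ (here a∉)     = a∉
  source∉ (step a∉ _ _) = a∉

  reverse : ∀ {a b} → WalkAvoiding G S a b → WalkAvoiding G S b a
  reverse (here a∉)     = here a∉
  reverse (step a∉ e w) = reverse w ++ step (source∉ w) (Graph.sym G e) (here a∉)

Adj⇒≢ : ∀ {n} (G : Graph n) {a b} → Adj G a b → a ≢ b
Adj⇒≢ G e refl = irrefl G e

preimage : ∀ {m n} → (Fin m → Fin n) → Subset n → Subset m
preimage f S = subset (λ x → f x ∈? S)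

module _ {m n} (f : Fin m → Fin n) (S : Subset n) where

  ∈preimage⁺ : ∀ {x} → f x ∈ S → x ∈ preimage f S
  ∈preimage⁺ = ∈subset⁺ (λ x → f x ∈? S)

  ∈preimage⁻ : ∀ {x} → x ∈ preimage f S → f x ∈ S
  ∈preimage⁻ = ∈subset⁻ (λ x → f x ∈? S)

  ∣preimage∣≤∣p∣ : (∀ x y → f x ≡ f y → x ≡ y) → ∣ preimage f S ∣ ≤ ∣ S ∣
  ∣preimage∣≤∣p∣ f-inj = injective⇒∣p∣≤∣q∣ (λ x v → f x ≡ v) (preimage f S) S
    (λ x∈ → f _ , ∈preimage⁻ x∈ , refl)
    (λ { refl e → f-inj _ _ (≡.sym e) })

  map-walk : {H : Graph m} {G : Graph n} →
    (∀ {x y} → Adj H x y → Adj G (f x) (f y)) →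
    ∀ {x y} → WalkAvoiding H (preimage f S) x y → WalkAvoiding G S (f x) (f y)
  map-walk hom (here x∉)     = here (x∉ ∘ ∈preimage⁺)
  map-walk hom (step x∉ e w) = step (x∉ ∘ ∈preimage⁺) (hom e) (map-walk hom w)

k<n-of-parts : ∀ {k t s n} {m : Fin t → ℕ} → (∀ a → k < m a) → k < t + s →
  (emb : (a : Fin t) → Fin (m a) → Fin n) → (u : Fin s → Fin n) →
  ((a : Fin t) → ∀ x y → emb a x ≡ emb a y → x ≡ y) →
  (∀ b c → u b ≡ u c → b ≡ c) → k < n
k<n-of-parts {t = zero}  k<m k<s emb u emb-inj u-inj =
  <-≤-trans k<s (injective⇒≤ λ {b} {c} → u-inj b c)
k<n-of-parts {t = suc _} k<m k<s emb u emb-inj u-inj =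
  <-≤-trans (k<m zero) (injective⇒≤ λ {x} {y} → emb-inj zero x y)

module Gluing
    (k t s : ℕ) (m : Fin t → ℕ) (Gs : (a : Fin t) → Graph (m a))
    (Gs-conn : (a : Fin t) → KConnected k (Gs a))
    (R : Graph (t + s)) (R-conn : KConnected k R)
    (n : ℕ) (G : Graph n)
    (emb : (a : Fin t) → Fin (m a) → Fin n)
    (u : Fin s → Fin n)
    (emb-inj : (a : Fin t) → ∀ x y → emb a x ≡ emb a y → x ≡ y)
    (emb-adj : (a : Fin t) → ∀ x y → Adj (Gs a) x y → Adj G (emb a x) (emb a y))
    (disjoint : ∀ i j v → InX emb u i v → InX emb u j v → i ≡ j)
    (cover : ∀ v → ∃ λ i → InX emb u i v)
    (R-edge : ∀ i j → i ≢ j → Adj R i j →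
      ∃ λ v → ∃ λ w → InX emb u i v × InX emb u j w × Adj G v w)
    (matching : (a : Fin t) →
      ∃ λ (js : Fin k → Fin (t + s)) →
      ∃ λ (x : Fin k → Fin n) →
      ∃ λ (y : Fin k → Fin n) →
        (∀ l l' → js l ≡ js l' → l ≡ l') ×
        (∀ l → js l ≢ (a ↑ˡ s)) ×
        (∀ l → InX emb u ((a ↑ˡ s)) (x l)) ×
        (∀ l → InX emb u (js l) (y l)) ×
        (∀ l → Adj G (x l) (y l)) ×
        (∀ l l' → l ≢ l' → (x l ≢ x l') × (x l ≢ y l') × (y l ≢ y l')))
    where

  X : Fin (t + s) → Fin n → Set
  X = InX emb u

  X? : ∀ i v → Dec (X i v)
  X? i v with splitAt t i
  ... | inj₁ a = any? (λ x → emb a x ≟ᶠ v)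
  ... | inj₂ b = u b ≟ᶠ v

  X-emb : ∀ a x → X (a ↑ˡ s) (emb a x)
  X-emb a x rewrite splitAt-↑ˡ t a s = x , refl

  module _ (S : Subset n) (∣S∣<k : ∣ S ∣ < k) where

    Walk : Fin n → Fin n → Set
    Walk = WalkAvoiding G S

    Hits : Fin (t + s) → Set
    Hits i = ∃ λ v → X i v × v ∈ S

    hits? : Decidable Hits
    hits? i = any? (λ v → X? i v ×-dec v ∈? S)

    hit : Subset (t + s)
    hit = subset hits?

    ∉hit⇒∉S : ∀ {i v} → i ∉ hit → X i v → v ∉ S
    ∉hit⇒∉S i∉ v∈Xi v∈S = i∉ (∈subset⁺ hits? (_ , v∈Xi , v∈S))

    ∣hit∣<k : ∣ hit ∣ < k
    ∣hit∣<k = ≤-<-trans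
      (injective⇒∣p∣≤∣q∣ X hit S
        (λ i∈ → let v , v∈Xi , v∈S = ∈subset⁻ hits? i∈ in v , v∈S , v∈Xi)
        (λ v∈Xi v∈Xj → disjoint _ _ _ v∈Xi v∈Xj))
      ∣S∣<k

    part-connected : ∀ {i c v} → X i c → X i v → c ∉ S → v ∉ S → Walk c v
    part-connected {i} c∈Xi v∈Xi c∉S v∉S with splitAt t i
    part-connected (x , refl) (x′ , refl) c∉S v∉S | inj₁ a =
      map-walk (emb a) S (emb-adj a _ _)
        (proj₂ (Gs-conn a) (preimage (emb a) S)
          (≤-<-trans (∣preimage∣≤∣p∣ (emb a) S (emb-inj a)) ∣S∣<k) x x′
          (c∉S ∘ ∈preimage⁻ (emb a) S) (v∉S ∘ ∈preimage⁻ (emb a) S))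
    part-connected refl refl c∉S v∉S | inj₂ b = here c∉S

    Escape : Fin n → Set
    Escape v = ∃ λ i → i ∉ hit × ∃ λ c → X i c × c ∉ S × Walk c v

    escape-part : ∀ a v → X (a ↑ˡ s) v → v ∉ S → Escape v
    escape-part a v v∈Xa v∉S with matching a
    ... | js , x , y , js-inj , js≢a , x∈Xa , y∈Xjs , xy-adj , independent
        with any? (λ l → ¬? (x l ∈? S) ×-dec ¬? (y l ∈? S) ×-dec ¬? (js l ∈? hit))
    ... | yes (l , x∉S , y∉S , js∉hit) =
      js l , js∉hit , y l , y∈Xjs l , y∉S ,
      step y∉S (Graph.sym G (xy-adj l)) (part-connected (x∈Xa l) v∈Xa x∉S v∉S)
    ... | no none-free = ⊥-elim (<⇒≱ ∣S∣<k (subst (_≤ ∣ S ∣) (∣⊤∣≡n k)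
          (injective⇒∣p∣≤∣q∣ Blocks ⊤ S (λ {l} _ → blocked l) blocks-injective)))
      where
      Blocks : Fin k → Fin n → Set
      Blocks l z = z ≡ x l ⊎ X (js l) z

      blocked : ∀ l → ∃ λ z → z ∈ S × Blocks l z
      blocked l with x l ∈? S | y l ∈? S | js l ∈? hit
      ... | yes x∈S | _       | _        = x l , x∈S , inj₁ refl
      ... | no _    | yes y∈S | _        = y l , y∈S , inj₂ (y∈Xjs l)
      ... | no _    | no _    | yes js∈  =
        let z , z∈Xjs , z∈S = ∈subset⁻ hits? js∈ in z , z∈S , inj₂ z∈Xjs
      ... | no x∉S  | no y∉S  | no js∉   = ⊥-elim (none-free (l , x∉S , y∉S , js∉))

      x-injective : ∀ {l l′} → x l ≡ x l′ → l ≡ l′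
      x-injective {l} {l′} e with l ≟ᶠ l′
      ... | yes l≡l′ = l≡l′
      ... | no l≢l′  = ⊥-elim (proj₁ (independent l l′ l≢l′) e)

      blocks-injective : ∀ {l l′ z} → Blocks l z → Blocks l′ z → l ≡ l′
      blocks-injective (inj₁ refl) (inj₁ e)     = x-injective e
      blocks-injective (inj₁ refl) (inj₂ z∈Xjs) =
        ⊥-elim (js≢a _ (disjoint _ _ _ z∈Xjs (x∈Xa _)))
      blocks-injective (inj₂ z∈Xjs) (inj₁ refl) =
        ⊥-elim (js≢a _ (disjoint _ _ _ z∈Xjs (x∈Xa _)))
      blocks-injective (inj₂ z∈Xjs) (inj₂ z∈Xjs′) =
        js-inj _ _ (disjoint _ _ _ z∈Xjs z∈Xjs′)

    escape : ∀ v → v ∉ S → Escape v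
    escape v v∉S with cover v
    ... | i , v∈Xi with i ∈? hit
    ... | no i∉hit = i , i∉hit , v , v∈Xi , v∉S , here v∉S
    ... | yes i∈hit with splitAt t i | ∈subset⁻ hits? i∈hit
    ... | inj₁ a | _ = let x , x≡v = v∈Xi in
      subst Escape x≡v (escape-part a (emb a x) (X-emb a x) (v∉S ∘ subst (_∈ S) x≡v))
    ... | inj₂ b | z , b≡z , z∈S = ⊥-elim (v∉S (subst (_∈ S) (trans (≡.sym b≡z) v∈Xi) z∈S))

    walk-across : ∀ {i j c d} → WalkAvoiding R hit i j →
      X i c → c ∉ S → X j d → d ∉ S → Walk c d
    walk-across (here _) c∈Xi c∉S d∈Xj d∉S = part-connected c∈Xi d∈Xj c∉S d∉S
    walk-across {i} (step {w = i′} i∉hit e w) c∈Xi c∉S d∈Xj d∉S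
      with R-edge i i′ (Adj⇒≢ R e) e
    ... | v , v′ , v∈Xi , v′∈Xi′ , vv′-adj =
      part-connected c∈Xi v∈Xi c∉S v∉S
        ++ step v∉S vv′-adj (walk-across w v′∈Xi′ (∉hit⇒∉S (source∉ w) v′∈Xi′) d∈Xj d∉S)
      where
      v∉S : v ∉ S
      v∉S = ∉hit⇒∉S i∉hit v∈Xi

    connected : ConnectedAvoiding G S
    connected v w v∉S w∉S with escape v v∉S | escape w w∉S
    ... | i , i∉hit , c , c∈Xi , c∉S , c→v | j , j∉hit , d , d∈Xj , d∉S , d→w =
      reverse c→v
        ++ walk-across (proj₂ R-conn hit ∣hit∣<k i j i∉hit j∉hit) c∈Xi c∉S d∈Xj d∉S
        ++ d→w

lemma6 : (k t s : ℕ) → 1 ≤ k →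
    (m : Fin t → ℕ) → (Gs : (a : Fin t) → Graph (m a)) →
    ((a : Fin t) → KConnected k (Gs a)) →
    (R : Graph (t + s)) → KConnected k R →
    (n : ℕ) → (G : Graph n) →
    (emb : (a : Fin t) → Fin (m a) → Fin n) →
    (u : Fin s → Fin n) →
    ((a : Fin t) → ∀ x y → emb a x ≡ emb a y → x ≡ y) →
    (∀ b c → u b ≡ u c → b ≡ c) →
    ((a : Fin t) → ∀ x y → Adj (Gs a) x y → Adj G (emb a x) (emb a y)) →
    (∀ i j v → InX emb u i v → InX emb u j v → i ≡ j) →
    (∀ v → ∃ λ i → InX emb u i v) →
    (∀ i j → i ≢ j → Adj R i j →
      ∃ λ v → ∃ λ w → InX emb u i v × InX emb u j w × Adj G v w) →
    ((a : Fin t) →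
      ∃ λ (js : Fin k → Fin (t + s)) →
      ∃ λ (x : Fin k → Fin n) →
      ∃ λ (y : Fin k → Fin n) →
        (∀ l l' → js l ≡ js l' → l ≡ l') ×
        (∀ l → js l ≢ (a ↑ˡ s)) ×
        (∀ l → InX emb u ((a ↑ˡ s)) (x l)) ×
        (∀ l → InX emb u (js l) (y l)) ×
        (∀ l → Adj G (x l) (y l)) ×
        (∀ l l' → l ≢ l' → (x l ≢ x l') × (x l ≢ y l') × (y l ≢ y l'))) →
    KConnected k G
lemma6 k t s _ m Gs Gs-conn R R-conn n G emb u emb-inj u-inj emb-adj
       disjoint cover R-edge matching =
  k<n-of-parts (proj₁ ∘ Gs-conn) (proj₁ R-conn) emb u emb-inj u-inj , connected
  where open Gluing k t s m Gs Gs-conn R R-conn n G emb u emb-inj emb-adj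
                    disjoint cover R-edge matching
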